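{- If $G$ and $H$ are i-games, then $-G$ and $G+H$ are i-games.
   Context: Well-tempered $\mathbb{Z}$-valued games: an even-tempered game is an integer (a "number", with no options) or $\langle L\mid R\rangle$ with $L,R$ finite nonempty sets of odd-tempered games; an odd-tempered game is $\langle L\mid R\rangle$ with $L,R$ finite nonempty sets of even-tempered games. Outcomes: $L(n)=R(n)=n$ for numbers; otherwise $L(G)=\max_{G^L}R(G^L)$, $R(G)=\min_{G^R}L(G^R)$. Negation: $-n$ for numbers, $-\langle G^L\mid G^R\rangle=\langle -G^R\mid -G^L\rangle$. Sum: integer sum if both numbers, otherwise $G+H=\langle G^L+H, G+H^L\mid G^R+H, G+H^R\rangle$. An i-game is a game all of whose options are i-games and which, if even-tempered, satisfies $L(G)\ge R(G)$. -}

module Defs where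

open import Data.Integer using (ℤ; _≤_; _⊔_; _⊓_) renaming (_+_ to _+ℤ_; -_ to -ℤ_)
open import Data.List using (List; []; _∷_)
open import Data.List.NonEmpty using (List⁺; _∷_; _⁺++⁺_)
open import Data.List.NonEmpty.Relation.Unary.All using (All)
open import Relation.Binary.PropositionalEquality using (_≡_)

data Temper : Set where
  even odd : Temper

flip : Temper → Temper
flip even = odd
flip odd  = even

_⊕_ : Temper → Temper → Temper
even ⊕ t = t
odd  ⊕ t = flip t

-- Well-tempered ℤ-valued games, indexed by temper.
-- Options are given by finite nonempty lists (finite nonempty sets up to
-- repetition/order, which do not affect any notion below).
data Game : Temper → Set where
  num  : ℤ → Game even
  ⟨_∣_⟩ : ∀ {t} → List⁺ (Game (flip t)) → List⁺ (Game (flip t)) → Game t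

mutual
  Lo : ∀ {t} → Game t → ℤ
  Lo (num n) = n
  Lo ⟨ x ∷ xs ∣ _ ⟩ = maxR (Ro x) xs

  Ro : ∀ {t} → Game t → ℤ
  Ro (num n) = n
  Ro ⟨ _ ∣ x ∷ xs ⟩ = minL (Lo x) xs

  maxR : ∀ {t} → ℤ → List (Game t) → ℤ
  maxR acc [] = acc
  maxR acc (y ∷ ys) = maxR (acc ⊔ Ro y) ys

  minL : ∀ {t} → ℤ → List (Game t) → ℤ
  minL acc [] = acc
  minL acc (y ∷ ys) = minL (acc ⊓ Lo y) ys

mutual
  neg : ∀ {t} → Game t → Game t
  neg (num n) = num (-ℤ n)
  neg ⟨ L ∣ R ⟩ = ⟨ negs R ∣ negs L ⟩

  negs⁰ : ∀ {t} → List (Game t) → List (Game t)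
  negs⁰ [] = []
  negs⁰ (x ∷ xs) = neg x ∷ negs⁰ xs

  negs : ∀ {t} → List⁺ (Game t) → List⁺ (Game t)
  negs (x ∷ xs) = neg x ∷ negs⁰ xs

mutual
  _+G_ : ∀ {s t} → Game s → Game t → Game (s ⊕ t)
  num m +G num n = num (m +ℤ n)
  num m +G ⟨ L ∣ R ⟩ = ⟨ addʳ (num m) L ∣ addʳ (num m) R ⟩
  _+G_ {even} {even} ⟨ L ∣ R ⟩ (num n) = ⟨ addˡ L (num n) ∣ addˡ R (num n) ⟩
  _+G_ {odd}  {even} ⟨ L ∣ R ⟩ (num n) = ⟨ addˡ L (num n) ∣ addˡ R (num n) ⟩
  _+G_ {even} {even} G@(⟨ L ∣ R ⟩) H@(⟨ L' ∣ R' ⟩) =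
    ⟨ addˡ L H ⁺++⁺ addʳ G L' ∣ addˡ R H ⁺++⁺ addʳ G R' ⟩
  _+G_ {even} {odd}  G@(⟨ L ∣ R ⟩) H@(⟨ L' ∣ R' ⟩) =
    ⟨ addˡ L H ⁺++⁺ addʳ G L' ∣ addˡ R H ⁺++⁺ addʳ G R' ⟩
  _+G_ {odd}  {even} G@(⟨ L ∣ R ⟩) H@(⟨ L' ∣ R' ⟩) =
    ⟨ addˡ L H ⁺++⁺ addʳ G L' ∣ addˡ R H ⁺++⁺ addʳ G R' ⟩
  _+G_ {odd}  {odd}  G@(⟨ L ∣ R ⟩) H@(⟨ L' ∣ R' ⟩) =
    ⟨ addˡ L H ⁺++⁺ addʳ G L' ∣ addˡ R H ⁺++⁺ addʳ G R' ⟩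

  addˡ⁰ : ∀ {s t} → List (Game s) → Game t → List (Game (s ⊕ t))
  addˡ⁰ [] h = []
  addˡ⁰ (x ∷ xs) h = (x +G h) ∷ addˡ⁰ xs h

  addˡ : ∀ {s t} → List⁺ (Game s) → Game t → List⁺ (Game (s ⊕ t))
  addˡ (x ∷ xs) h = (x +G h) ∷ addˡ⁰ xs h

  addʳ⁰ : ∀ {s t} → Game s → List (Game t) → List (Game (s ⊕ t))
  addʳ⁰ g [] = []
  addʳ⁰ g (x ∷ xs) = (g +G x) ∷ addʳ⁰ g xs

  addʳ : ∀ {s t} → Game s → List⁺ (Game t) → List⁺ (Game (s ⊕ t))
  addʳ g (x ∷ xs) = (g +G x) ∷ addʳ⁰ g xs

data IGame : ∀ {t} → Game t → Set where
  inum  : ∀ n → IGame (num n)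
  inode : ∀ {t} {L R : List⁺ (Game (flip t))} →
          All IGame L → All IGame R →
          (t ≡ even → Ro ⟨ L ∣ R ⟩ ≤ Lo ⟨ L ∣ R ⟩) →
          IGame ⟨ L ∣ R ⟩

module Submission where

-- Negation: the outcomes satisfy L(-G) = -R(G) and R(-G) = -L(G), so negation preserves
-- the i-condition R ≤ L, and the options of -G are the negations of the options of G.
--
-- Sum: when G + H is even-tempered, G and H have the same temper and the i-condition
-- follows from the chain  R(G+H) ≤ R(G) + L(H) ≤ L(G+H).  These are two of six outcome
-- bounds for sums of i-games, each valid except for one combination of tempers:
--   L(G) + R(H) ≤ L(G+H)  and  R(G+H) ≤ R(G) + L(H)   unless G is even and H odd,
--   R(G) + L(H) ≤ L(G+H)  and  R(G+H) ≤ L(G) + R(H)   unless G is odd and H even,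
--   R(G) + R(H) ≤ R(G+H)  and  L(G+H) ≤ L(G) + L(H)   unless G and H are both odd.
-- Each bound at (G, H) follows from another bound at (X, H) or (G, Y) for an option X of G
-- or Y of H, so all six, together with "G + H is an i-game", are proved by one
-- well-founded induction on size G + size H.

open import Defs
open import Data.Product using (_×_)

open import Data.Product using (Σ; _,_; proj₁; proj₂)
open import Data.Sum using (_⊎_; inj₁; inj₂)
open import Data.Empty using (⊥; ⊥-elim)
open import Data.Unit using (⊤; tt)
open import Data.Nat as ℕ using (ℕ; suc; s≤s)
import Data.Nat.Properties as ℕₚ
open import Data.Nat.Induction using (<-wellFounded)
open import Induction.WellFounded using (Acc; acc)
open import Data.Integer using (_+_; _≤_; -_; _⊔_; _⊓_)
open import Data.Integer.Properties
open import Data.List using (List; []; _∷_; map; _++_)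
open import Data.List.Properties using (++-identityʳ)
open import Data.List.NonEmpty using (List⁺; _∷_; toList; _⁺++⁺_)
open import Data.List.NonEmpty.Relation.Unary.All using (All; _∷_; toList⁺)
import Data.List.Relation.Unary.All as ListAll
open import Data.List.Relation.Unary.Any using (here; there)
open import Data.List.Membership.Propositional using (_∈_)
open import Data.List.Membership.Propositional.Properties using (∈-map⁺; ∈-map⁻; ∈-++⁺ˡ; ∈-++⁺ʳ; ∈-++⁻)
open import Relation.Binary.PropositionalEquality
  using (_≡_; _≢_; refl; sym; trans; cong; cong₂; subst; subst₂)

maxR-acc : ∀ {t} a (ys : List (Game t)) → a ≤ maxR a ys
maxR-acc a [] = ≤-refl
maxR-acc a (y ∷ ys) = ≤-trans (i≤i⊔j a (Ro y)) (maxR-acc (a ⊔ Ro y) ys)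

maxR-ub : ∀ {t} a (ys : List (Game t)) {y} → y ∈ ys → Ro y ≤ maxR a ys
maxR-ub a (y ∷ ys) (here refl) = ≤-trans (i≤j⊔i a (Ro y)) (maxR-acc (a ⊔ Ro y) ys)
maxR-ub a (y ∷ ys) (there y∈) = maxR-ub (a ⊔ Ro y) ys y∈

maxR-att : ∀ {t} a (ys : List (Game t)) → (maxR a ys ≤ a) ⊎ Σ (Game t) (λ y → y ∈ ys × maxR a ys ≤ Ro y)
maxR-att a [] = inj₁ ≤-refl
maxR-att a (y ∷ ys) with maxR-att (a ⊔ Ro y) ys
... | inj₂ (z , z∈ , le) = inj₂ (z , there z∈ , le)
... | inj₁ le with ⊔-sel a (Ro y)
...   | inj₁ eq = inj₁ (subst (maxR (a ⊔ Ro y) ys ≤_) eq le)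
...   | inj₂ eq = inj₂ (y , here refl , subst (maxR (a ⊔ Ro y) ys ≤_) eq le)

minL-acc : ∀ {t} a (ys : List (Game t)) → minL a ys ≤ a
minL-acc a [] = ≤-refl
minL-acc a (y ∷ ys) = ≤-trans (minL-acc (a ⊓ Lo y) ys) (i⊓j≤i a (Lo y))

minL-lb : ∀ {t} a (ys : List (Game t)) {y} → y ∈ ys → minL a ys ≤ Lo y
minL-lb a (y ∷ ys) (here refl) = ≤-trans (minL-acc (a ⊓ Lo y) ys) (i⊓j≤j a (Lo y))
minL-lb a (y ∷ ys) (there y∈) = minL-lb (a ⊓ Lo y) ys y∈

minL-att : ∀ {t} a (ys : List (Game t)) → (a ≤ minL a ys) ⊎ Σ (Game t) (λ y → y ∈ ys × Lo y ≤ minL a ys)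
minL-att a [] = inj₁ ≤-refl
minL-att a (y ∷ ys) with minL-att (a ⊓ Lo y) ys
... | inj₂ (z , z∈ , le) = inj₂ (z , there z∈ , le)
... | inj₁ le with ⊓-sel a (Lo y)
...   | inj₁ eq = inj₁ (subst (_≤ minL (a ⊓ Lo y) ys) eq le)
...   | inj₂ eq = inj₂ (y , here refl , subst (_≤ minL (a ⊓ Lo y) ys) eq le)

Lopt : ∀ {t} → Game t → List (Game (flip t))
Lopt (num _) = []
Lopt ⟨ L ∣ _ ⟩ = toList L

Ropt : ∀ {t} → Game t → List (Game (flip t))
Ropt (num _) = []
Ropt ⟨ _ ∣ R ⟩ = toList R

_≺_ : ∀ {t} → Game (flip t) → Game t → Set
X ≺ G = X ∈ Lopt G ⊎ X ∈ Ropt G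

IsNode : ∀ {t} → Game t → Set
IsNode (num _) = ⊥
IsNode ⟨ _ ∣ _ ⟩ = ⊤

Lo-ub : ∀ {t} (G : Game t) {X} → X ∈ Lopt G → Ro X ≤ Lo G
Lo-ub ⟨ x ∷ xs ∣ _ ⟩ (here refl) = maxR-acc (Ro x) xs
Lo-ub ⟨ x ∷ xs ∣ _ ⟩ (there X∈) = maxR-ub (Ro x) xs X∈

Lo-att : ∀ {t} (L R : List⁺ (Game (flip t))) → Σ (Game (flip t)) (λ X → X ∈ toList L × Lo ⟨ L ∣ R ⟩ ≤ Ro X)
Lo-att (x ∷ xs) R with maxR-att (Ro x) xs
... | inj₁ le = x , here refl , le
... | inj₂ (z , z∈ , le) = z , there z∈ , le

Lo-lub : ∀ {t} (L R : List⁺ (Game (flip t))) {c} → (∀ {X} → X ∈ toList L → Ro X ≤ c) → Lo ⟨ L ∣ R ⟩ ≤ c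
Lo-lub L R bound = let (X , X∈ , le) = Lo-att L R in ≤-trans le (bound X∈)

Ro-lb : ∀ {t} (G : Game t) {X} → X ∈ Ropt G → Ro G ≤ Lo X
Ro-lb ⟨ _ ∣ x ∷ xs ⟩ (here refl) = minL-acc (Lo x) xs
Ro-lb ⟨ _ ∣ x ∷ xs ⟩ (there X∈) = minL-lb (Lo x) xs X∈

Ro-att : ∀ {t} (L R : List⁺ (Game (flip t))) → Σ (Game (flip t)) (λ X → X ∈ toList R × Lo X ≤ Ro ⟨ L ∣ R ⟩)
Ro-att L (x ∷ xs) with minL-att (Lo x) xs
... | inj₁ le = x , here refl , le
... | inj₂ (z , z∈ , le) = z , there z∈ , le

Ro-glb : ∀ {t} (L R : List⁺ (Game (flip t))) {c} → (∀ {X} → X ∈ toList R → c ≤ Lo X) → c ≤ Ro ⟨ L ∣ R ⟩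
Ro-glb L R bound = let (X , X∈ , le) = Ro-att L R in ≤-trans (bound X∈) le

-- The left options of G + H are the games X + H (X ∈ Lopt G) and
-- G + Y (Y ∈ Lopt H).  Their tempers agree with that of G + H only after case analysis
-- on tempers, so this is expressed through temper-polymorphic properties: a property holds
-- on all of Zs iff it holds on every f X (X ∈ A) and every g Y (Y ∈ B).

GameProp : Set₁
GameProp = ∀ {v} → Game v → Set

record Union {a b c d w} (A : List (Game a)) (f : Game a → Game c)
             (B : List (Game b)) (g : Game b → Game d) (Zs : List (Game w)) : Set₁ where
  field
    cover : (P : GameProp) → (∀ {X} → X ∈ A → P (f X)) → (∀ {Y} → Y ∈ B → P (g Y)) →
            ∀ {Z} → Z ∈ Zs → P Z
    incˡ  : (P : GameProp) → (∀ {Z} → Z ∈ Zs → P Z) → ∀ {X} → X ∈ A → P (f X)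
    incʳ  : (P : GameProp) → (∀ {Z} → Z ∈ Zs → P Z) → ∀ {Y} → Y ∈ B → P (g Y)
open Union

union-map : ∀ {a b c} (A : List (Game a)) (f : Game a → Game c) (B : List (Game b)) (g : Game b → Game c) →
            Union A f B g (map f A ++ map g B)
cover (union-map A f B g) P onA onB Z∈ with ∈-++⁻ (map f A) Z∈
... | inj₁ Z∈fA with ∈-map⁻ f Z∈fA
...   | _ , X∈ , refl = onA X∈
cover (union-map A f B g) P onA onB Z∈ | inj₂ Z∈gB with ∈-map⁻ g Z∈gB
...   | _ , Y∈ , refl = onB Y∈
incˡ (union-map A f B g) P onZs X∈ = onZs (∈-++⁺ˡ (∈-map⁺ f X∈))
incʳ (union-map A f B g) P onZs Y∈ = onZs (∈-++⁺ʳ (map f A) (∈-map⁺ g Y∈))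

addˡ-map : ∀ {s t} (L : List⁺ (Game s)) (h : Game t) → toList (addˡ L h) ≡ map (_+G h) (toList L)
addˡ-map (x ∷ xs) h = cong (x +G h ∷_) (addˡ⁰-map xs)
  where
  addˡ⁰-map : ∀ xs → addˡ⁰ xs h ≡ map (_+G h) xs
  addˡ⁰-map [] = refl
  addˡ⁰-map (y ∷ ys) = cong (y +G h ∷_) (addˡ⁰-map ys)

addʳ-map : ∀ {s t} (g : Game s) (L : List⁺ (Game t)) → toList (addʳ g L) ≡ map (g +G_) (toList L)
addʳ-map g (x ∷ xs) = cong (g +G x ∷_) (addʳ⁰-map xs)
  where
  addʳ⁰-map : ∀ xs → addʳ⁰ g xs ≡ map (g +G_) xs
  addʳ⁰-map [] = refl
  addʳ⁰-map (y ∷ ys) = cong (g +G y ∷_) (addʳ⁰-map ys)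

union-left : ∀ {a b w} {A : List (Game a)} {f : Game a → Game w} {g : Game b → Game w}
             (Zs : List⁺ (Game w)) → toList Zs ≡ map f A → Union A f [] g (toList Zs)
union-left {A = A} {f} {g} Zs eq =
  subst (Union A f [] g) (sym (trans eq (sym (++-identityʳ _)))) (union-map A f [] g)

union-right : ∀ {a b w} {f : Game a → Game w} {B : List (Game b)} {g : Game b → Game w}
              (Zs : List⁺ (Game w)) → toList Zs ≡ map g B → Union [] f B g (toList Zs)
union-right {f = f} {B} {g} Zs eq = subst (Union [] f B g) (sym eq) (union-map [] f B g)

union-both : ∀ {a b w} {A : List (Game a)} {f : Game a → Game w} {B : List (Game b)} {g : Game b → Game w}
             (Zs Zs' : List⁺ (Game w)) → toList Zs ≡ map f A → toList Zs' ≡ map g B →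
             Union A f B g (toList (Zs ⁺++⁺ Zs'))
union-both {A = A} {f} {B} {g} Zs Zs' eq eq' =
  subst (Union A f B g) (sym (cong₂ _++_ eq eq')) (union-map A f B g)

-- Shape of a sum with at least one summand a game node: a node whose option lists are the
-- unions above.  Stated as an eliminator, since the temper of G + H is computed.
sumView : ∀ {s t} (G : Game s) (H : Game t) → IsNode G ⊎ IsNode H → (C : GameProp) →
          (∀ {u} (Ls Rs : List⁺ (Game (flip u))) →
             Union (Lopt G) (_+G H) (Lopt H) (G +G_) (toList Ls) →
             Union (Ropt G) (_+G H) (Ropt H) (G +G_) (toList Rs) → C ⟨ Ls ∣ Rs ⟩) →
          C (G +G H)
sumView (num _) (num _) (inj₁ ())
sumView (num _) (num _) (inj₂ ())
sumView G@(num _) ⟨ L ∣ R ⟩ _ C k =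
  k _ _ (union-right _ (addʳ-map G L)) (union-right _ (addʳ-map G R))
sumView {even} ⟨ L ∣ R ⟩ H@(num _) _ C k =
  k _ _ (union-left _ (addˡ-map L H)) (union-left _ (addˡ-map R H))
sumView {odd} ⟨ L ∣ R ⟩ H@(num _) _ C k =
  k _ _ (union-left _ (addˡ-map L H)) (union-left _ (addˡ-map R H))
sumView {even} {even} G@(⟨ L ∣ R ⟩) H@(⟨ L' ∣ R' ⟩) _ C k =
  k _ _ (union-both _ _ (addˡ-map L H) (addʳ-map G L')) (union-both _ _ (addˡ-map R H) (addʳ-map G R'))
sumView {even} {odd} G@(⟨ L ∣ R ⟩) H@(⟨ L' ∣ R' ⟩) _ C k =
  k _ _ (union-both _ _ (addˡ-map L H) (addʳ-map G L')) (union-both _ _ (addˡ-map R H) (addʳ-map G R'))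
sumView {odd} {even} G@(⟨ L ∣ R ⟩) H@(⟨ L' ∣ R' ⟩) _ C k =
  k _ _ (union-both _ _ (addˡ-map L H) (addʳ-map G L')) (union-both _ _ (addˡ-map R H) (addʳ-map G R'))
sumView {odd} {odd} G@(⟨ L ∣ R ⟩) H@(⟨ L' ∣ R' ⟩) _ C k =
  k _ _ (union-both _ _ (addˡ-map L H) (addʳ-map G L')) (union-both _ _ (addˡ-map R H) (addʳ-map G R'))

sum-Lo-ubˡ : ∀ {s t} (G : Game s) (H : Game t) {X} → X ∈ Lopt G → Ro (X +G H) ≤ Lo (G +G H)
sum-Lo-ubˡ G@(⟨ _ ∣ _ ⟩) H {X} X∈ = sumView G H (inj₁ tt) (λ S → Ro (X +G H) ≤ Lo S)
  (λ Ls Rs unionL _ → incˡ unionL (λ Z → Ro Z ≤ Lo ⟨ Ls ∣ Rs ⟩) (Lo-ub ⟨ Ls ∣ Rs ⟩) X∈)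

sum-Lo-ubʳ : ∀ {s t} (G : Game s) (H : Game t) {Y} → Y ∈ Lopt H → Ro (G +G Y) ≤ Lo (G +G H)
sum-Lo-ubʳ G H@(⟨ _ ∣ _ ⟩) {Y} Y∈ = sumView G H (inj₂ tt) (λ S → Ro (G +G Y) ≤ Lo S)
  (λ Ls Rs unionL _ → incʳ unionL (λ Z → Ro Z ≤ Lo ⟨ Ls ∣ Rs ⟩) (Lo-ub ⟨ Ls ∣ Rs ⟩) Y∈)

sum-Lo-lub : ∀ {s t} (G : Game s) (H : Game t) {c} → IsNode G ⊎ IsNode H →
             (∀ {X} → X ∈ Lopt G → Ro (X +G H) ≤ c) → (∀ {Y} → Y ∈ Lopt H → Ro (G +G Y) ≤ c) →
             Lo (G +G H) ≤ c
sum-Lo-lub G H {c} node boundˡ boundʳ = sumView G H node (λ S → Lo S ≤ c)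
  (λ Ls Rs unionL _ → Lo-lub Ls Rs (cover unionL (λ Z → Ro Z ≤ c) boundˡ boundʳ))

sum-Ro-lbˡ : ∀ {s t} (G : Game s) (H : Game t) {X} → X ∈ Ropt G → Ro (G +G H) ≤ Lo (X +G H)
sum-Ro-lbˡ G@(⟨ _ ∣ _ ⟩) H {X} X∈ = sumView G H (inj₁ tt) (λ S → Ro S ≤ Lo (X +G H))
  (λ Ls Rs _ unionR → incˡ unionR (λ Z → Ro ⟨ Ls ∣ Rs ⟩ ≤ Lo Z) (Ro-lb ⟨ Ls ∣ Rs ⟩) X∈)

sum-Ro-lbʳ : ∀ {s t} (G : Game s) (H : Game t) {Y} → Y ∈ Ropt H → Ro (G +G H) ≤ Lo (G +G Y)
sum-Ro-lbʳ G H@(⟨ _ ∣ _ ⟩) {Y} Y∈ = sumView G H (inj₂ tt) (λ S → Ro S ≤ Lo (G +G Y))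
  (λ Ls Rs _ unionR → incʳ unionR (λ Z → Ro ⟨ Ls ∣ Rs ⟩ ≤ Lo Z) (Ro-lb ⟨ Ls ∣ Rs ⟩) Y∈)

sum-Ro-glb : ∀ {s t} (G : Game s) (H : Game t) {c} → IsNode G ⊎ IsNode H →
             (∀ {X} → X ∈ Ropt G → c ≤ Lo (X +G H)) → (∀ {Y} → Y ∈ Ropt H → c ≤ Lo (G +G Y)) →
             c ≤ Ro (G +G H)
sum-Ro-glb G H {c} node boundˡ boundʳ = sumView G H node (λ S → c ≤ Ro S)
  (λ Ls Rs _ unionR → Ro-glb Ls Rs (cover unionR (λ Z → c ≤ Lo Z) boundˡ boundʳ))

mutual
  size : ∀ {t} → Game t → ℕ
  size (num _) = 0
  size ⟨ L ∣ R ⟩ = suc (sizes⁺ L ℕ.+ sizes⁺ R)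

  sizes⁺ : ∀ {t} → List⁺ (Game t) → ℕ
  sizes⁺ (x ∷ xs) = size x ℕ.+ sizes xs

  sizes : ∀ {t} → List (Game t) → ℕ
  sizes [] = 0
  sizes (x ∷ xs) = size x ℕ.+ sizes xs

size-∈ : ∀ {t} (xs : List (Game t)) {x} → x ∈ xs → size x ℕ.≤ sizes xs
size-∈ (x ∷ xs) (here refl) = ℕₚ.m≤m+n (size x) (sizes xs)
size-∈ (y ∷ xs) (there x∈) = ℕₚ.≤-trans (size-∈ xs x∈) (ℕₚ.m≤n+m (sizes xs) (size y))

≺-size : ∀ {t} (G : Game t) {X} → X ≺ G → size X ℕ.< size G
≺-size ⟨ L@(x ∷ xs) ∣ R ⟩ (inj₁ X∈) = s≤s (ℕₚ.≤-trans (size-∈ (x ∷ xs) X∈) (ℕₚ.m≤m+n (sizes⁺ L) (sizes⁺ R)))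
≺-size ⟨ L ∣ R@(x ∷ xs) ⟩ (inj₂ X∈) = s≤s (ℕₚ.≤-trans (size-∈ (x ∷ xs) X∈) (ℕₚ.m≤n+m (sizes⁺ R) (sizes⁺ L)))

≺-IGame : ∀ {t} {G : Game t} → IGame G → ∀ {X} → X ≺ G → IGame X
≺-IGame (inode allL _ _) (inj₁ X∈) = ListAll.lookup (toList⁺ allL) X∈
≺-IGame (inode _ allR _) (inj₂ X∈) = ListAll.lookup (toList⁺ allR) X∈

i-condition : ∀ {G : Game even} → IGame G → Ro G ≤ Lo G
i-condition (inum n) = ≤-refl
i-condition (inode _ _ cond) = cond refl

_≢ₜ_ : Temper × Temper → Temper × Temper → Set
p ≢ₜ q = p ≢ q

flip-injective : ∀ {s a} → flip s ≡ flip a → s ≡ a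
flip-injective {even} {even} _ = refl
flip-injective {odd} {odd} _ = refl
flip-injective {even} {odd} ()
flip-injective {odd} {even} ()

flipˡ : ∀ {s t a b} → (s , t) ≢ₜ (a , b) → (flip s , t) ≢ₜ (flip a , b)
flipˡ ne eq = ne (cong₂ _,_ (flip-injective (cong proj₁ eq)) (cong proj₂ eq))

flipʳ : ∀ {s t a b} → (s , t) ≢ₜ (a , b) → (s , flip t) ≢ₜ (a , flip b)
flipʳ ne eq = ne (cong₂ _,_ (cong proj₁ eq) (flip-injective (cong proj₂ eq)))

record SumBounds {s t} (G : Game s) (H : Game t) : Set where
  field
    LG+RH≤L : (s , t) ≢ₜ (even , odd) → Lo G + Ro H ≤ Lo (G +G H)
    R≤RG+LH : (s , t) ≢ₜ (even , odd) → Ro (G +G H) ≤ Ro G + Lo H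
    RG+LH≤L : (s , t) ≢ₜ (odd , even) → Ro G + Lo H ≤ Lo (G +G H)
    R≤LG+RH : (s , t) ≢ₜ (odd , even) → Ro (G +G H) ≤ Lo G + Ro H
    RG+RH≤R : (s , t) ≢ₜ (odd , odd) → Ro G + Ro H ≤ Ro (G +G H)
    L≤LG+LH : (s , t) ≢ₜ (odd , odd) → Lo (G +G H) ≤ Lo G + Lo H
open SumBounds

record BoundsIH {s t} (G : Game s) (H : Game t) : Set where
  field
    igG : IGame G
    igH : IGame H
    byG : ∀ {X} → X ≺ G → SumBounds X H
    byH : ∀ {Y} → Y ≺ H → SumBounds G Y
open BoundsIH

-- The mixed bounds for a game node G (resp. H): use the option of G (resp. H) attaining
-- its outcome and the same-side bound for it.

LG+RH≤L-viaG : ∀ {s t} (L R : List⁺ (Game (flip s))) (H : Game t) → BoundsIH ⟨ L ∣ R ⟩ H →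
               (s , t) ≢ₜ (even , odd) → Lo ⟨ L ∣ R ⟩ + Ro H ≤ Lo (⟨ L ∣ R ⟩ +G H)
LG+RH≤L-viaG L R H ih ne =
  let (X , X∈ , LG≤RX) = Lo-att L R in
  begin
    Lo ⟨ L ∣ R ⟩ + Ro H   ≤⟨ +-monoˡ-≤ (Ro H) LG≤RX ⟩
    Ro X + Ro H           ≤⟨ RG+RH≤R (byG ih (inj₁ X∈)) (flipˡ ne) ⟩
    Ro (X +G H)           ≤⟨ sum-Lo-ubˡ ⟨ L ∣ R ⟩ H X∈ ⟩
    Lo (⟨ L ∣ R ⟩ +G H)   ∎
  where open ≤-Reasoning

R≤RG+LH-viaG : ∀ {s t} (L R : List⁺ (Game (flip s))) (H : Game t) → BoundsIH ⟨ L ∣ R ⟩ H →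
               (s , t) ≢ₜ (even , odd) → Ro (⟨ L ∣ R ⟩ +G H) ≤ Ro ⟨ L ∣ R ⟩ + Lo H
R≤RG+LH-viaG L R H ih ne =
  let (X , X∈ , LX≤RG) = Ro-att L R in
  begin
    Ro (⟨ L ∣ R ⟩ +G H)   ≤⟨ sum-Ro-lbˡ ⟨ L ∣ R ⟩ H X∈ ⟩
    Lo (X +G H)           ≤⟨ L≤LG+LH (byG ih (inj₂ X∈)) (flipˡ ne) ⟩
    Lo X + Lo H           ≤⟨ +-monoˡ-≤ (Lo H) LX≤RG ⟩
    Ro ⟨ L ∣ R ⟩ + Lo H   ∎
  where open ≤-Reasoning

RG+LH≤L-viaH : ∀ {s t} (G : Game s) (L R : List⁺ (Game (flip t))) → BoundsIH G ⟨ L ∣ R ⟩ →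
               (s , t) ≢ₜ (odd , even) → Ro G + Lo ⟨ L ∣ R ⟩ ≤ Lo (G +G ⟨ L ∣ R ⟩)
RG+LH≤L-viaH G L R ih ne =
  let (Y , Y∈ , LH≤RY) = Lo-att L R in
  begin
    Ro G + Lo ⟨ L ∣ R ⟩   ≤⟨ +-monoʳ-≤ (Ro G) LH≤RY ⟩
    Ro G + Ro Y           ≤⟨ RG+RH≤R (byH ih (inj₁ Y∈)) (flipʳ ne) ⟩
    Ro (G +G Y)           ≤⟨ sum-Lo-ubʳ G ⟨ L ∣ R ⟩ Y∈ ⟩
    Lo (G +G ⟨ L ∣ R ⟩)   ∎
  where open ≤-Reasoning

R≤LG+RH-viaH : ∀ {s t} (G : Game s) (L R : List⁺ (Game (flip t))) → BoundsIH G ⟨ L ∣ R ⟩ →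
               (s , t) ≢ₜ (odd , even) → Ro (G +G ⟨ L ∣ R ⟩) ≤ Lo G + Ro ⟨ L ∣ R ⟩
R≤LG+RH-viaH G L R ih ne =
  let (Y , Y∈ , LY≤RH) = Ro-att L R in
  begin
    Ro (G +G ⟨ L ∣ R ⟩)   ≤⟨ sum-Ro-lbʳ G ⟨ L ∣ R ⟩ Y∈ ⟩
    Lo (G +G Y)           ≤⟨ L≤LG+LH (byH ih (inj₂ Y∈)) (flipʳ ne) ⟩
    Lo G + Lo Y           ≤⟨ +-monoʳ-≤ (Lo G) LY≤RH ⟩
    Lo G + Ro ⟨ L ∣ R ⟩   ∎
  where open ≤-Reasoning

-- The same-side bounds for a sum that is a game node: compare with each of its options,
-- using the mixed bounds for them.

RG+RH≤R-node : ∀ {s t} (G : Game s) (H : Game t) → IsNode G ⊎ IsNode H → BoundsIH G H →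
               (s , t) ≢ₜ (odd , odd) → Ro G + Ro H ≤ Ro (G +G H)
RG+RH≤R-node G H node ih ne = sum-Ro-glb G H node
  (λ {X} X∈ → ≤-trans (+-monoˡ-≤ (Ro H) (Ro-lb G X∈)) (LG+RH≤L (byG ih (inj₂ X∈)) (flipˡ ne)))
  (λ {Y} Y∈ → ≤-trans (+-monoʳ-≤ (Ro G) (Ro-lb H Y∈)) (RG+LH≤L (byH ih (inj₂ Y∈)) (flipʳ ne)))

L≤LG+LH-node : ∀ {s t} (G : Game s) (H : Game t) → IsNode G ⊎ IsNode H → BoundsIH G H →
               (s , t) ≢ₜ (odd , odd) → Lo (G +G H) ≤ Lo G + Lo H
L≤LG+LH-node G H node ih ne = sum-Lo-lub G H node
  (λ {X} X∈ → ≤-trans (R≤RG+LH (byG ih (inj₁ X∈)) (flipˡ ne)) (+-monoˡ-≤ (Lo H) (Lo-ub G X∈)))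
  (λ {Y} Y∈ → ≤-trans (R≤LG+RH (byH ih (inj₁ Y∈)) (flipʳ ne)) (+-monoʳ-≤ (Lo G) (Lo-ub H Y∈)))

-- Sums of two numbers are trivial; a number m plus a game node of
-- the other side reduces to the bound via that node and the i-condition R ≤ L for it
-- (the side condition forces it to be even-tempered).

LG+RH≤L-step : ∀ {s t} (G : Game s) (H : Game t) → BoundsIH G H →
               (s , t) ≢ₜ (even , odd) → Lo G + Ro H ≤ Lo (G +G H)
LG+RH≤L-step (num m) (num n) _ _ = ≤-refl
LG+RH≤L-step ⟨ L ∣ R ⟩ H ih ne = LG+RH≤L-viaG L R H ih ne
LG+RH≤L-step {t = odd} (num m) ⟨ _ ∣ _ ⟩ _ ne = ⊥-elim (ne refl)
LG+RH≤L-step {t = even} (num m) ⟨ L ∣ R ⟩ ih _ =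
  ≤-trans (+-monoʳ-≤ m (i-condition (igH ih))) (RG+LH≤L-viaH (num m) L R ih (λ ()))

R≤RG+LH-step : ∀ {s t} (G : Game s) (H : Game t) → BoundsIH G H →
               (s , t) ≢ₜ (even , odd) → Ro (G +G H) ≤ Ro G + Lo H
R≤RG+LH-step (num m) (num n) _ _ = ≤-refl
R≤RG+LH-step ⟨ L ∣ R ⟩ H ih ne = R≤RG+LH-viaG L R H ih ne
R≤RG+LH-step {t = odd} (num m) ⟨ _ ∣ _ ⟩ _ ne = ⊥-elim (ne refl)
R≤RG+LH-step {t = even} (num m) ⟨ L ∣ R ⟩ ih _ =
  ≤-trans (R≤LG+RH-viaH (num m) L R ih (λ ())) (+-monoʳ-≤ m (i-condition (igH ih)))

RG+LH≤L-step : ∀ {s t} (G : Game s) (H : Game t) → BoundsIH G H →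
               (s , t) ≢ₜ (odd , even) → Ro G + Lo H ≤ Lo (G +G H)
RG+LH≤L-step (num m) (num n) _ _ = ≤-refl
RG+LH≤L-step G ⟨ L ∣ R ⟩ ih ne = RG+LH≤L-viaH G L R ih ne
RG+LH≤L-step {odd} ⟨ _ ∣ _ ⟩ (num n) _ ne = ⊥-elim (ne refl)
RG+LH≤L-step {even} ⟨ L ∣ R ⟩ (num n) ih _ =
  ≤-trans (+-monoˡ-≤ n (i-condition (igG ih))) (LG+RH≤L-viaG L R (num n) ih (λ ()))

R≤LG+RH-step : ∀ {s t} (G : Game s) (H : Game t) → BoundsIH G H →
               (s , t) ≢ₜ (odd , even) → Ro (G +G H) ≤ Lo G + Ro H
R≤LG+RH-step (num m) (num n) _ _ = ≤-refl
R≤LG+RH-step G ⟨ L ∣ R ⟩ ih ne = R≤LG+RH-viaH G L R ih ne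
R≤LG+RH-step {odd} ⟨ _ ∣ _ ⟩ (num n) _ ne = ⊥-elim (ne refl)
R≤LG+RH-step {even} ⟨ L ∣ R ⟩ (num n) ih _ =
  ≤-trans (R≤RG+LH-viaG L R (num n) ih (λ ())) (+-monoˡ-≤ n (i-condition (igG ih)))

RG+RH≤R-step : ∀ {s t} (G : Game s) (H : Game t) → BoundsIH G H →
               (s , t) ≢ₜ (odd , odd) → Ro G + Ro H ≤ Ro (G +G H)
RG+RH≤R-step (num m) (num n) _ _ = ≤-refl
RG+RH≤R-step G@(num _) H@(⟨ _ ∣ _ ⟩) = RG+RH≤R-node G H (inj₂ tt)
RG+RH≤R-step G@(⟨ _ ∣ _ ⟩) H = RG+RH≤R-node G H (inj₁ tt)

L≤LG+LH-step : ∀ {s t} (G : Game s) (H : Game t) → BoundsIH G H →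
               (s , t) ≢ₜ (odd , odd) → Lo (G +G H) ≤ Lo G + Lo H
L≤LG+LH-step (num m) (num n) _ _ = ≤-refl
L≤LG+LH-step G@(num _) H@(⟨ _ ∣ _ ⟩) = L≤LG+LH-node G H (inj₂ tt)
L≤LG+LH-step G@(⟨ _ ∣ _ ⟩) H = L≤LG+LH-node G H (inj₁ tt)

sumBounds-step : ∀ {s t} (G : Game s) (H : Game t) → BoundsIH G H → SumBounds G H
sumBounds-step G H ih = record
  { LG+RH≤L = LG+RH≤L-step G H ih ; R≤RG+LH = R≤RG+LH-step G H ih
  ; RG+LH≤L = RG+LH≤L-step G H ih ; R≤LG+RH = R≤LG+RH-step G H ih
  ; RG+RH≤R = RG+RH≤R-step G H ih ; L≤LG+LH = L≤LG+LH-step G H ih }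

-- An even-tempered sum has summands of equal temper, so R(G+H) ≤ R(G) + L(H) ≤ L(G+H).
sum-i-condition : ∀ {s t} {G : Game s} {H : Game t} → SumBounds G H →
                  s ⊕ t ≡ even → Ro (G +G H) ≤ Lo (G +G H)
sum-i-condition {even} {even} bounds _ = ≤-trans (R≤RG+LH bounds (λ ())) (RG+LH≤L bounds (λ ()))
sum-i-condition {odd} {odd} bounds _ = ≤-trans (R≤RG+LH bounds (λ ())) (RG+LH≤L bounds (λ ()))

tabulate⁺ : ∀ {A : Set} {P : A → Set} (xs : List⁺ A) → (∀ {x} → x ∈ toList xs → P x) → All P xs
tabulate⁺ (x ∷ xs) onAll with ListAll.tabulate onAll
... | px ListAll.∷ pxs = px ∷ pxs

sum-IGame-node : ∀ {s t} (G : Game s) (H : Game t) → IsNode G ⊎ IsNode H →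
                 (∀ {X} → X ≺ G → IGame (X +G H)) → (∀ {Y} → Y ≺ H → IGame (G +G Y)) →
                 (s ⊕ t ≡ even → Ro (G +G H) ≤ Lo (G +G H)) → IGame (G +G H)
sum-IGame-node G H node igX igY = sumView G H node (λ {u} S → (u ≡ even → Ro S ≤ Lo S) → IGame S)
  (λ Ls Rs unionL unionR → inode
    (tabulate⁺ Ls (cover unionL IGame (λ X∈ → igX (inj₁ X∈)) (λ Y∈ → igY (inj₁ Y∈))))
    (tabulate⁺ Rs (cover unionR IGame (λ X∈ → igX (inj₂ X∈)) (λ Y∈ → igY (inj₂ Y∈)))))

sum-IGame : ∀ {s t} (G : Game s) (H : Game t) →
            (∀ {X} → X ≺ G → IGame (X +G H)) → (∀ {Y} → Y ≺ H → IGame (G +G Y)) →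
            (s ⊕ t ≡ even → Ro (G +G H) ≤ Lo (G +G H)) → IGame (G +G H)
sum-IGame (num m) (num n) _ _ _ = inum (m + n)
sum-IGame G@(num _) H@(⟨ _ ∣ _ ⟩) = sum-IGame-node G H (inj₂ tt)
sum-IGame G@(⟨ _ ∣ _ ⟩) H = sum-IGame-node G H (inj₁ tt)

record SumFacts {s t} (G : Game s) (H : Game t) : Set where
  field
    bounds : SumBounds G H
    closed : IGame (G +G H)
open SumFacts

sumFacts : ∀ {s t} (G : Game s) (H : Game t) → Acc ℕ._<_ (size G ℕ.+ size H) →
           IGame G → IGame H → SumFacts G H
sumFacts G H (acc smaller) iG iH = record
  { bounds = bounds-GH
  ; closed = sum-IGame G H (λ X≺G → closed (factsG X≺G)) (λ Y≺H → closed (factsH Y≺H))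
                       (sum-i-condition bounds-GH) }
  where
  factsG : ∀ {X} → X ≺ G → SumFacts X H
  factsG {X} X≺G = sumFacts X H (smaller (ℕₚ.+-monoˡ-< (size H) (≺-size G X≺G))) (≺-IGame iG X≺G) iH

  factsH : ∀ {Y} → Y ≺ H → SumFacts G Y
  factsH {Y} Y≺H = sumFacts G Y (smaller (ℕₚ.+-monoʳ-< (size G) (≺-size H Y≺H))) iG (≺-IGame iH Y≺H)

  bounds-GH : SumBounds G H
  bounds-GH = sumBounds-step G H (record
    { igG = iG ; igH = iH ; byG = λ X≺G → bounds (factsG X≺G) ; byH = λ Y≺H → bounds (factsH Y≺H) })

mutual
  neg-Lo : ∀ {t} (G : Game t) → Lo (neg G) ≡ - Ro G
  neg-Lo (num n) = refl
  neg-Lo ⟨ _ ∣ x ∷ xs ⟩ = maxR-negs xs (neg-Ro x)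

  neg-Ro : ∀ {t} (G : Game t) → Ro (neg G) ≡ - Lo G
  neg-Ro (num n) = refl
  neg-Ro ⟨ x ∷ xs ∣ _ ⟩ = minL-negs xs (neg-Lo x)

  maxR-negs : ∀ {t} (xs : List (Game t)) {a b} → b ≡ - a → maxR b (negs⁰ xs) ≡ - minL a xs
  maxR-negs [] b≡-a = b≡-a
  maxR-negs (y ∷ ys) {a} b≡-a =
    maxR-negs ys (trans (cong₂ _⊔_ b≡-a (neg-Ro y)) (sym (neg-distrib-⊓-⊔ a (Lo y))))

  minL-negs : ∀ {t} (xs : List (Game t)) {a b} → b ≡ - a → minL b (negs⁰ xs) ≡ - maxR a xs
  minL-negs [] b≡-a = b≡-a
  minL-negs (y ∷ ys) {a} b≡-a =
    minL-negs ys (trans (cong₂ _⊓_ b≡-a (neg-Lo y)) (sym (neg-distrib-⊔-⊓ a (Ro y))))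

mutual
  neg-IGame : ∀ {t} {G : Game t} → IGame G → IGame (neg G)
  neg-IGame (inum n) = inum _
  neg-IGame {G = G} (inode allL allR cond) = inode (negs-IGame allR) (negs-IGame allL)
    (λ even → subst₂ _≤_ (sym (neg-Ro G)) (sym (neg-Lo G)) (neg-mono-≤ (cond even)))

  negs-IGame : ∀ {t} {xs : List⁺ (Game t)} → All IGame xs → All IGame (negs xs)
  negs-IGame (p ∷ ps) = neg-IGame p ∷ negs⁰-IGame ps

  negs⁰-IGame : ∀ {t} {xs : List (Game t)} → ListAll.All IGame xs → ListAll.All IGame (negs⁰ xs)
  negs⁰-IGame ListAll.[] = ListAll.[]
  negs⁰-IGame (p ListAll.∷ ps) = neg-IGame p ListAll.∷ negs⁰-IGame ps

mainTheorem4 : ∀ {s t} (G : Game s) (H : Game t) → IGame G → IGame H → IGame (neg G) × IGame (G +G H)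
mainTheorem4 G H iG iH = neg-IGame iG , closed (sumFacts G H (<-wellFounded _) iG iH)
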